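{- For all integers $n\ge 1$ and $c\ge 2$, each of the sets $E_{c^n}$ and $O_{c^n}$ can be partitioned into $(2^{c-1})^n$ subsets such that every subcube of $Q_{c^n}$ of dimension $c^n-c^{n-1}+1$ contains a vertex from each subset in each of the two partitions.
   Context: $Q_N$ is the hypercube graph on $\{0,1\}^N$. $E_N$ denotes the set of vectors in $\{0,1\}^N$ with an even number of $1$'s and $O_N$ the set with an odd number of $1$'s. A $d$-dimensional subcube of $Q_N$ is obtained by choosing $N-d$ coordinates and fixed values in $\{0,1\}$ for them, and taking all $2^d$ vectors agreeing with these fixed values. -}

module Defs where

open import Data.Nat using (ℕ; zero; suc; _+_; _%_)
open import Data.Bool using (Bool; true; false)
open import Data.Maybe using (Maybe; just; nothing)
open import Data.Vec using (Vec; []; _∷_; lookup)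
open import Data.Fin using (Fin)
open import Relation.Binary.PropositionalEquality using (_≡_)

Vertex : ℕ → Set
Vertex N = Vec Bool N

ones : ∀ {N} → Vertex N → ℕ
ones [] = 0
ones (true ∷ v) = suc (ones v)
ones (false ∷ v) = ones v

IsEven : ∀ {N} → Vertex N → Set
IsEven v = ones v % 2 ≡ 0

IsOdd : ∀ {N} → Vertex N → Set
IsOdd v = ones v % 2 ≡ 1

-- A subcube of Q_N: for each coordinate either a fixed value (just b)
-- or free (nothing).
Subcube : ℕ → Set
Subcube N = Vec (Maybe Bool) N

dim : ∀ {N} → Subcube N → ℕ
dim [] = 0
dim (nothing ∷ s) = suc (dim s)
dim (just _ ∷ s) = dim s

_∈Cube_ : ∀ {N} → Vertex N → Subcube N → Set
v ∈Cube s = ∀ i {b} → lookup s i ≡ just b → lookup v i ≡ b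

-- Split a vertex of Q_{c^(n+1)} into c blocks of length c^n, recursively. Its signature
-- is a list of n+1 vectors in {0,1}^c: the parities of its c blocks, followed by the XOR
-- over the blocks of their own signatures. Every vector of the signature has the parity
-- of the vertex, so dropping its first bit leaves (2^(c-1))^(n+1) classes.
-- A subcube with fewer than c^n fixed coordinates has a free coordinate in every block
-- and, by pigeonhole, a block with fewer than c^(n-1) fixed coordinates. Give the other
-- blocks arbitrary prescribed parities; by induction the good block realises any
-- consistent signature, in particular the one that XORs with the others to the target.
module Submission where

open import Defs
open import Data.Nat using (ℕ; _+_; _∸_; _^_; _≥_; zero; suc; _*_; _<_; _≤_; s≤s; _<?_; _%_)
open import Data.Fin using (Fin)
open import Data.Product using (Σ; _×_; _,_; proj₁; proj₂)
open import Relation.Binary.PropositionalEquality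
  using (_≡_; refl; sym; trans; cong; cong₂; subst; module ≡-Reasoning)

open import Algebra.Bundles using (CommutativeRing)
open import Data.Bool using (Bool; true; false; _xor_; not)
open import Data.Bool.Properties
  using (xor-assoc; xor-comm; xor-same; xor-identityʳ; xor-∧-commutativeRing)
open import Algebra.Properties.CommutativeSemigroup
  (CommutativeRing.+-commutativeSemigroup xor-∧-commutativeRing) using (interchange)
import Data.Fin as F
open import Data.Fin.Base using (funToFin; finToFun)
open import Data.Fin.Properties using (funToFin-finToFin; 2↔Bool)
open import Data.Maybe using (Maybe; just; nothing)
open import Data.Nat.DivMod using (%-distribˡ-+)
open import Data.Nat.Properties
  using (+-suc; +-comm; +-monoˡ-≤; +-cancelˡ-<; +-cancelʳ-≡; m≤m+n; m≤n+m; ≤-<-trans;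
         ≤-reflexive; ≮⇒≥; n<1⇒n≡0; m+[n∸m]≡n)
open import Data.Unit using (⊤; tt)
open import Data.Vec
  using (Vec; []; _∷_; [_]; _++_; concat; group; map; zipWith; replicate; lookup; tabulate; tail; sum)
open import Data.Vec.Properties
  using (++-injective; zipWith-comm; map-∘; map-cong; map-id; lookup∘tabulate)
open import Data.Vec.Relation.Binary.Pointwise.Inductive as Pointwise
  using (Pointwise; concat⁺)
open import Data.Vec.Relation.Unary.All as All using (All)
open import Data.Vec.Relation.Unary.All.Properties using (map⁻)
open import Function using (_∘_)
open import Function.Bundles using (Inverse)
open import Relation.Nullary using (yes; no)

private
  variable
    A : Set
    m n r N : ℕ

xor-cancelʳ : ∀ x y → (x xor y) xor y ≡ x
xor-cancelʳ x y = trans (xor-assoc x y y) (trans (cong (x xor_) (xor-same y)) (xor-identityʳ x))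

xor-cancelˡ : ∀ x y → (x xor y) xor x ≡ y
xor-cancelˡ x y = trans (cong (_xor x) (xor-comm x y)) (xor-cancelʳ y x)

zipWith-cancelʳ : {f : A → A → A} → (∀ x y → f (f x y) y ≡ x) →
                  (xs ys : Vec A n) → zipWith f (zipWith f xs ys) ys ≡ xs
zipWith-cancelʳ cancel []       []       = refl
zipWith-cancelʳ cancel (x ∷ xs) (y ∷ ys) = cong₂ _∷_ (cancel x y) (zipWith-cancelʳ cancel xs ys)

concat-injective : {xss yss : Vec (Vec A m) n} → concat xss ≡ concat yss → xss ≡ yss
concat-injective {xss = []}      {[]}      _  = refl
concat-injective {xss = xs ∷ xss} {ys ∷ yss} eq =
  let xs≡ys , rest = ++-injective xs ys eq in cong₂ _∷_ xs≡ys (concat-injective rest)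

blocks : ∀ r m → Vec A (r * m) → Vec (Vec A m) r
blocks r m xs = proj₁ (group r m xs)

concat-blocks : ∀ r m (xs : Vec A (r * m)) → concat (blocks r m xs) ≡ xs
concat-blocks r m xs = sym (proj₂ (group r m xs))

blocks-concat : (xss : Vec (Vec A m) r) → blocks r m (concat xss) ≡ xss
blocks-concat {m = m} {r} xss = concat-injective (concat-blocks r m (concat xss))

sum<⇒All< : ∀ {b} (xs : Vec ℕ n) → sum xs < b → All (_< b) xs
sum<⇒All< []       _  = All.[]
sum<⇒All< (x ∷ xs) lt =
  ≤-<-trans (m≤m+n x (sum xs)) lt All.∷ sum<⇒All< xs (≤-<-trans (m≤n+m (sum xs) x) lt)

Vec-zero-unique : (xs : Vec A 0) → xs ≡ []
Vec-zero-unique [] = refl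

a+b<x+y⇒b<y : ∀ {a b x y} → x ≤ a → a + b < x + y → b < y
a+b<x+y⇒b<y {a} {b} {x} {y} x≤a lt = +-cancelˡ-< x b y (≤-<-trans (+-monoˡ-≤ b x≤a) lt)

parity : Vec Bool n → Bool
parity []       = false
parity (x ∷ xs) = x xor parity xs

parity-++ : (xs : Vec Bool m) (ys : Vec Bool n) → parity (xs ++ ys) ≡ parity xs xor parity ys
parity-++ []       ys = refl
parity-++ (x ∷ xs) ys = trans (cong (x xor_) (parity-++ xs ys)) (sym (xor-assoc x (parity xs) (parity ys)))

parity-concat : (xss : Vec (Vec Bool m) n) → parity (concat xss) ≡ parity (map parity xss)
parity-concat []         = refl
parity-concat (xs ∷ xss) = trans (parity-++ xs (concat xss)) (cong (parity xs xor_) (parity-concat xss))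

parity-zipWith-xor : (xs ys : Vec Bool n) → parity (zipWith _xor_ xs ys) ≡ parity xs xor parity ys
parity-zipWith-xor []       []       = refl
parity-zipWith-xor (x ∷ xs) (y ∷ ys) =
  trans (cong ((x xor y) xor_) (parity-zipWith-xor xs ys)) (interchange x y (parity xs) (parity ys))

parity-replicate-false : ∀ n → parity (replicate n false) ≡ false
parity-replicate-false zero    = refl
parity-replicate-false (suc n) = parity-replicate-false n

map-parity-singletons : (xs : Vec Bool n) → map parity (map [_] xs) ≡ xs
map-parity-singletons xs = trans (sym (map-∘ parity [_] xs)) (trans (map-cong xor-identityʳ xs) (map-id xs))

bit : Bool → ℕ
bit false = 0
bit true  = 1

[1+bit]%2 : ∀ b → (1 + bit b) % 2 ≡ bit (not b)
[1+bit]%2 false = refl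
[1+bit]%2 true  = refl

ones-%2 : (v : Vertex n) → ones v % 2 ≡ bit (parity v)
ones-%2 []          = refl
ones-%2 (false ∷ v) = ones-%2 v
ones-%2 (true ∷ v)  = begin
  (1 + ones v) % 2           ≡⟨ %-distribˡ-+ 1 (ones v) 2 ⟩
  (1 + ones v % 2) % 2       ≡⟨ cong (λ r → (1 + r) % 2) (ones-%2 v) ⟩
  (1 + bit (parity v)) % 2   ≡⟨ [1+bit]%2 (parity v) ⟩
  bit (not (parity v))       ∎
  where open ≡-Reasoning

parity-false⇒IsEven : (v : Vertex n) → parity v ≡ false → IsEven v
parity-false⇒IsEven v eq = trans (ones-%2 v) (cong bit eq)

parity-true⇒IsOdd : (v : Vertex n) → parity v ≡ true → IsOdd v
parity-true⇒IsOdd v eq = trans (ones-%2 v) (cong bit eq)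

fixed : Subcube n → ℕ
fixed []             = 0
fixed (nothing ∷ s)  = fixed s
fixed (just _ ∷ s)   = suc (fixed s)

dim+fixed : (s : Subcube n) → dim s + fixed s ≡ n
dim+fixed []            = refl
dim+fixed (nothing ∷ s) = cong suc (dim+fixed s)
dim+fixed (just _ ∷ s)  = trans (+-suc (dim s) (fixed s)) (cong suc (dim+fixed s))

fixed-++ : (s : Subcube m) (t : Subcube n) → fixed (s ++ t) ≡ fixed s + fixed t
fixed-++ []            t = refl
fixed-++ (nothing ∷ s) t = fixed-++ s t
fixed-++ (just _ ∷ s)  t = cong suc (fixed-++ s t)

fixed-concat : (ss : Vec (Subcube m) n) → fixed (concat ss) ≡ sum (map fixed ss)
fixed-concat []       = refl
fixed-concat (s ∷ ss) = trans (fixed-++ s (concat ss)) (cong (fixed s +_) (fixed-concat ss))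

fixed<-of-dim : ∀ {a} (s : Subcube N) → a ≤ N → dim s ≡ N ∸ a + 1 → fixed s < a
fixed<-of-dim {N} {a} s a≤N dim≡ = ≤-reflexive (+-cancelʳ-≡ (N ∸ a) (suc (fixed s)) a (begin
  suc (fixed s) + (N ∸ a)    ≡⟨ cong suc (+-comm (fixed s) (N ∸ a)) ⟩
  suc (N ∸ a + fixed s)      ≡⟨ cong (_+ fixed s) (+-comm 1 (N ∸ a)) ⟩
  N ∸ a + 1 + fixed s        ≡⟨ cong (_+ fixed s) (sym dim≡) ⟩
  dim s + fixed s            ≡⟨ dim+fixed s ⟩
  N                          ≡⟨ sym (m+[n∸m]≡n a≤N) ⟩
  a + (N ∸ a)                ∎))
  where open ≡-Reasoning

Fits : Bool → Maybe Bool → Set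
Fits x nothing  = ⊤
Fits x (just b) = x ≡ b

Fits-just : ∀ {x b m} → Fits x m → m ≡ just b → x ≡ b
Fits-just fits refl = fits

Pointwise-Fits⇒∈Cube : {v : Vertex n} {s : Subcube n} → Pointwise Fits v s → v ∈Cube s
Pointwise-Fits⇒∈Cube fits i = Fits-just (Pointwise.lookup fits i)

Fits-unfixed : (v : Vertex n) (s : Subcube n) → fixed s ≡ 0 → Pointwise Fits v s
Fits-unfixed []      []            _  = Pointwise.[]
Fits-unfixed (x ∷ v) (nothing ∷ s) eq = tt Pointwise.∷ Fits-unfixed v s eq

anchor : Subcube n → Vertex n
anchor []             = []
anchor (nothing ∷ s)  = false ∷ anchor s
anchor (just b ∷ s)   = b ∷ anchor s

anchor-fits : (s : Subcube n) → Pointwise Fits (anchor s) s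
anchor-fits []            = Pointwise.[]
anchor-fits (nothing ∷ s) = tt Pointwise.∷ anchor-fits s
anchor-fits (just b ∷ s)  = refl Pointwise.∷ anchor-fits s

vertexWithParity : (s : Subcube n) → fixed s < n → ∀ b →
                   Σ (Vertex n) λ v → Pointwise Fits v s × parity v ≡ b
vertexWithParity (nothing ∷ s) _ b =
  (b xor parity (anchor s)) ∷ anchor s , tt Pointwise.∷ anchor-fits s ,
  xor-cancelʳ b (parity (anchor s))
vertexWithParity (just x ∷ s) (s≤s lt) b =
  let v , fits , parity≡ = vertexWithParity s lt (b xor x)
  in x ∷ v , refl Pointwise.∷ fits ,
     trans (cong (x xor_) parity≡) (trans (xor-comm x (b xor x)) (xor-cancelʳ b x))

verticesWithParities : ∀ {M} (ss : Vec (Subcube M) r) → All (λ s → fixed s < M) ss →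
  (t : Vec Bool r) → Σ (Vec (Vertex M) r) λ vs → Pointwise (Pointwise Fits) vs ss × map parity vs ≡ t
verticesWithParities []       All.[]          []      = [] , Pointwise.[] , refl
verticesWithParities (s ∷ ss) (lt All.∷ lts) (b ∷ t) =
  let v , fits , parity≡ = vertexWithParity s lt b
      vs , fitss , parities≡ = verticesWithParities ss lts t
  in v ∷ vs , fits Pointwise.∷ fitss , cong₂ _∷_ parity≡ parities≡

module Signature (c : ℕ) where

  Sig : ℕ → Set
  Sig n = Vec (Vec Bool c) n

  _⊕_ : Sig n → Sig n → Sig n
  _⊕_ = zipWith (zipWith _xor_)

  ⊕-comm : (S T : Sig n) → S ⊕ T ≡ T ⊕ S
  ⊕-comm = zipWith-comm (zipWith-comm xor-comm)

  ⊕-cancelʳ : (S T : Sig n) → (S ⊕ T) ⊕ T ≡ S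
  ⊕-cancelʳ = zipWith-cancelʳ (zipWith-cancelʳ xor-cancelʳ)

  ⨁ : Vec (Sig n) r → Sig n
  ⨁ []       = replicate _ (replicate c false)
  ⨁ (S ∷ Ss) = S ⊕ ⨁ Ss

  signature : ∀ n → Vertex (c ^ n) → Sig n
  signature zero    v = []
  signature (suc n) v = map parity vs ∷ ⨁ (map (signature n) vs)
    where vs = blocks c (c ^ n) v

  signature-concat : (vs : Vec (Vertex (c ^ n)) c) →
                     signature (suc n) (concat vs) ≡ map parity vs ∷ ⨁ (map (signature n) vs)
  signature-concat {n} vs = cong (λ ws → map parity ws ∷ ⨁ (map (signature n) ws)) (blocks-concat vs)

  Consistent : Bool → Sig n → Set
  Consistent p = All (λ t → parity t ≡ p)

  Consistent-resp : ∀ {p q} {T : Sig n} → p ≡ q → Consistent p T → Consistent q T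
  Consistent-resp refl consistent = consistent

  Consistent-unique : ∀ {p q} {T : Sig (suc n)} → Consistent p T → Consistent q T → p ≡ q
  Consistent-unique (p≡ All.∷ _) (q≡ All.∷ _) = trans (sym p≡) q≡

  Consistent-⊕ : ∀ {p q} {S T : Sig n} → Consistent p S → Consistent q T → Consistent (p xor q) (S ⊕ T)
  Consistent-⊕ All.[] All.[] = All.[]
  Consistent-⊕ {S = s ∷ _} {t ∷ _} (p≡ All.∷ cs) (q≡ All.∷ ct) =
    trans (parity-zipWith-xor s t) (cong₂ _xor_ p≡ q≡) All.∷ Consistent-⊕ cs ct

  Consistent-zero : ∀ n → Consistent false (replicate n (replicate c false))
  Consistent-zero zero    = All.[]
  Consistent-zero (suc n) = parity-replicate-false c All.∷ Consistent-zero n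

  Consistent-⨁ : {f : A → Sig n} {g : A → Bool} → (∀ x → Consistent (g x) (f x)) →
                 (xs : Vec A r) → Consistent (parity (map g xs)) (⨁ (map f xs))
  Consistent-⨁ {n = n} consistent []       = Consistent-zero n
  Consistent-⨁ consistent (x ∷ xs) = Consistent-⊕ (consistent x) (Consistent-⨁ consistent xs)

  signature-consistent : ∀ n (v : Vertex (c ^ n)) → Consistent (parity v) (signature n v)
  signature-consistent zero    v = All.[]
  signature-consistent (suc n) v =
    Consistent-resp parity-blocks (refl All.∷ Consistent-⨁ (signature-consistent n) vs)
    where
      vs = blocks c (c ^ n) v
      parity-blocks : parity (map parity vs) ≡ parity v
      parity-blocks = trans (sym (parity-concat vs)) (cong parity (concat-blocks c (c ^ n) v))

  RealisesSignatures : ∀ n → Subcube (c ^ suc n) → Set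
  RealisesSignatures n s = ∀ {p} (T : Sig (suc n)) → Consistent p T →
                  Σ (Vertex (c ^ suc n)) λ v → Pointwise Fits v s × signature (suc n) v ≡ T

  realiseOnBlocks : (∀ (s : Subcube (c ^ suc n)) → fixed s < c ^ n → RealisesSignatures n s) →
    (ss : Vec (Subcube (c ^ suc n)) r) → All (λ s → fixed s < c ^ suc n) ss →
    sum (map fixed ss) < r * c ^ n →
    (t : Vec Bool r) (T : Sig (suc n)) → Consistent (parity t) T →
    Σ (Vec (Vertex (c ^ suc n)) r) λ vs →
      Pointwise (Pointwise Fits) vs ss × map parity vs ≡ t × ⨁ (map (signature (suc n)) vs) ≡ T
  realiseOnBlocks _ [] _ ()
  -- A good first block absorbs the signatures of the others; a bad one has at least c^n fixed
  -- coordinates, so the remaining blocks inherit the pigeonhole bound.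
  realiseOnBlocks {n} reach (s ∷ ss) (free All.∷ frees) bound (b ∷ t) T consistent with fixed s <? c ^ n
  ... | yes good =
    let vs , fitss , parities≡ = verticesWithParities ss frees t
        R = ⨁ (map (signature (suc n)) vs)
        consistentR : Consistent (parity t) R
        consistentR = subst (λ q → Consistent (parity q) R) parities≡
                            (Consistent-⨁ (signature-consistent (suc n)) vs)
        consistentT⊕R : Consistent b (T ⊕ R)
        consistentT⊕R = Consistent-resp (xor-cancelʳ b (parity t)) (Consistent-⊕ consistent consistentR)
        v , fits , signature≡ = reach s good (T ⊕ R) consistentT⊕R
        parity≡ = Consistent-unique (signature-consistent (suc n) v)
                                    (subst (Consistent b) (sym signature≡) consistentT⊕R)
    in v ∷ vs , fits Pointwise.∷ fitss , cong₂ _∷_ parity≡ parities≡ ,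
       trans (cong (_⊕ R) signature≡) (⊕-cancelʳ T R)
  ... | no bad =
    let v , fits , parity≡ = vertexWithParity s free b
        S = signature (suc n) v
        consistentS : Consistent b S
        consistentS = Consistent-resp parity≡ (signature-consistent (suc n) v)
        consistentT⊕S : Consistent (parity t) (T ⊕ S)
        consistentT⊕S = Consistent-resp (xor-cancelˡ b (parity t)) (Consistent-⊕ consistent consistentS)
        vs , fitss , parities≡ , sum≡ =
          realiseOnBlocks reach ss frees (a+b<x+y⇒b<y (≮⇒≥ bad) bound) t (T ⊕ S) consistentT⊕S
    in v ∷ vs , fits Pointwise.∷ fitss , cong₂ _∷_ parity≡ parities≡ ,
       trans (cong (S ⊕_) sum≡) (trans (⊕-comm S (T ⊕ S)) (⊕-cancelʳ T S))

  realisesSignatures : ∀ n (s : Subcube (c ^ suc n)) → fixed s < c ^ n → RealisesSignatures n s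
  realisesSignatures zero s unfixed (t ∷ []) _ =
    concat (map [_] t) , Fits-unfixed _ s (n<1⇒n≡0 unfixed) ,
    trans (signature-concat (map [_] t)) (cong₂ _∷_ (map-parity-singletons t) (Vec-zero-unique _))
  realisesSignatures (suc n) s bound (t ∷ T) (parity≡ All.∷ consistent) =
    let ss = blocks c (c ^ suc n) s
        fixed≡ : fixed s ≡ sum (map fixed ss)
        fixed≡ = trans (cong fixed (sym (concat-blocks c (c ^ suc n) s))) (fixed-concat ss)
        bound′ = subst (_< c ^ suc n) fixed≡ bound
        vs , fitss , parities≡ , sum≡ =
          realiseOnBlocks (realisesSignatures n) ss (map⁻ (sum<⇒All< (map fixed ss) bound′)) bound′ t T
                   (Consistent-resp (sym parity≡) consistent)
    in concat vs , subst (Pointwise Fits (concat vs)) (concat-blocks c (c ^ suc n) s) (concat⁺ fitss) ,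
       trans (signature-concat vs) (cong₂ _∷_ parities≡ sum≡)

funToFin-cong : ∀ {b} {f g : Fin m → Fin b} → (∀ i → f i ≡ g i) → funToFin f ≡ funToFin g
funToFin-cong {zero}  _  = refl
funToFin-cong {suc m} eq = cong₂ F.combine (eq F.zero) (funToFin-cong (eq ∘ F.suc))

encodeVec : ∀ {b} → (A → Fin b) → Vec A m → Fin (b ^ m)
encodeVec encode v = funToFin (encode ∘ lookup v)

decodeVec : ∀ {b} m → (Fin b → A) → Fin (b ^ m) → Vec A m
decodeVec m decode i = tabulate (decode ∘ finToFun i)

encodeVec-decodeVec : ∀ {b} m (encode : A → Fin b) (decode : Fin b → A) → (∀ x → encode (decode x) ≡ x) →
                      (i : Fin (b ^ m)) → encodeVec encode (decodeVec m decode i) ≡ i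
encodeVec-decodeVec m encode decode inverse i =
  trans (funToFin-cong {m} (λ j → trans (cong encode (lookup∘tabulate (decode ∘ finToFun i) j)) (inverse _)))
        (funToFin-finToFin {m} i)

module Classes (k : ℕ) where
  open Signature (suc k)

  open Inverse 2↔Bool using (to; from; strictlyInverseʳ)

  encodeClass : Vec (Vec Bool k) n → Fin ((2 ^ k) ^ n)
  encodeClass = encodeVec (encodeVec from)

  decodeClass : ∀ n → Fin ((2 ^ k) ^ n) → Vec (Vec Bool k) n
  decodeClass n = decodeVec n (decodeVec k to)

  encodeClass-decodeClass : ∀ n (j : Fin ((2 ^ k) ^ n)) → encodeClass (decodeClass n j) ≡ j
  encodeClass-decodeClass n =
    encodeVec-decodeVec n (encodeVec from) (decodeVec k to) (encodeVec-decodeVec k from to strictlyInverseʳ)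

  class : ∀ n → Vertex (suc k ^ n) → Fin ((2 ^ k) ^ n)
  class n v = encodeClass (map tail (signature n v))

  withParity : Bool → Vec (Vec Bool k) n → Sig n
  withParity p = map (λ t → (p xor parity t) ∷ t)

  Consistent-withParity : ∀ p (ts : Vec (Vec Bool k) n) → Consistent p (withParity p ts)
  Consistent-withParity p []       = All.[]
  Consistent-withParity p (t ∷ ts) = xor-cancelʳ p (parity t) All.∷ Consistent-withParity p ts

  map-tail-withParity : ∀ p (ts : Vec (Vec Bool k) n) → map tail (withParity p ts) ≡ ts
  map-tail-withParity p ts = trans (sym (map-∘ tail _ ts)) (map-id ts)

  subcube-meets-class : ∀ n p (s : Subcube (suc k ^ suc n)) → dim s ≡ suc k ^ suc n ∸ suc k ^ n + 1 →
    (j : Fin ((2 ^ k) ^ suc n)) →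
    Σ (Vertex (suc k ^ suc n)) λ v → v ∈Cube s × parity v ≡ p × class (suc n) v ≡ j
  subcube-meets-class n p s dim≡ j =
    let T = withParity p (decodeClass (suc n) j)
        consistent = Consistent-withParity p (decodeClass (suc n) j)
        bound = fixed<-of-dim s (m≤m+n (suc k ^ n) (k * suc k ^ n)) dim≡
        v , fits , signature≡ = realisesSignatures n s bound T consistent
    in v , Pointwise-Fits⇒∈Cube fits ,
       Consistent-unique (signature-consistent (suc n) v) (subst (Consistent p) (sym signature≡) consistent) ,
       trans (cong (encodeClass ∘ map tail) signature≡)
             (trans (cong encodeClass (map-tail-withParity p (decodeClass (suc n) j)))
                    (encodeClass-decodeClass (suc n) j))

lemma9 : (n c : ℕ) → n ≥ 1 → c ≥ 2 →
    (Σ (Vertex (c ^ n) → Fin ((2 ^ (c ∸ 1)) ^ n)) λ f →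
      (s : Subcube (c ^ n)) → dim s ≡ c ^ n ∸ c ^ (n ∸ 1) + 1 →
        (j : Fin ((2 ^ (c ∸ 1)) ^ n)) →
          Σ (Vertex (c ^ n)) λ v → v ∈Cube s × IsEven v × f v ≡ j)
    ×
    (Σ (Vertex (c ^ n) → Fin ((2 ^ (c ∸ 1)) ^ n)) λ g →
      (s : Subcube (c ^ n)) → dim s ≡ c ^ n ∸ c ^ (n ∸ 1) + 1 →
        (j : Fin ((2 ^ (c ∸ 1)) ^ n)) →
          Σ (Vertex (c ^ n)) λ v → v ∈Cube s × IsOdd v × g v ≡ j)
lemma9 (suc n) (suc (suc k)) _ _ =
    (class (suc n) , λ s dim≡ j →
       let v , v∈s , parity≡ , class≡ = subcube-meets-class n false s dim≡ j
       in v , v∈s , parity-false⇒IsEven v parity≡ , class≡)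
  , (class (suc n) , λ s dim≡ j →
       let v , v∈s , parity≡ , class≡ = subcube-meets-class n true s dim≡ j
       in v , v∈s , parity-true⇒IsOdd v parity≡ , class≡)
  where open Classes (suc k)
lemma9 (suc n) (suc zero) _ (s≤s ())
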